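{- For every non-negative integer $N$, \[\sum_{\pi\in\mathcal{D}_{\le N}} (-1)^{\mathcal{E}(\pi)} q^{\mathcal{O}(\pi)} = (-q;q^2)_{\lceil N/2\rceil},\qquad \sum_{\pi\in\mathcal{P}_{\le N}} (-1)^{\mathcal{E}(\pi)} q^{\mathcal{O}(\pi)} = \frac{1}{(q^2;q^2)_{\lfloor N/2\rfloor}}.\]
   Context: A partition $\pi=(\lambda_1,\lambda_2,\dots)$ is a finite non-increasing sequence of positive integers; the empty sequence is the unique partition of $0$. $\mathcal{P}_{\le N}$ is the set of partitions with all parts $\le N$, $\mathcal{D}_{\le N}$ the set of partitions into distinct parts all $\le N$. $\mathcal{O}(\pi)=\lambda_1+\lambda_3+\cdots$, $\mathcal{E}(\pi)=\lambda_2+\lambda_4+\cdots$. $(a;q)_l=\prod_{i=0}^{l-1}(1-aq^i)$. Identities of formal power series in $q$. -}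

module Defs where

open import Data.Nat using (ℕ; zero; suc; _+_; _*_; _∸_; _≤ᵇ_; _<ᵇ_; _≡ᵇ_)
open import Data.Integer as ℤ using (ℤ; 0ℤ; 1ℤ; -1ℤ)
open import Data.List using (List; []; _∷_; map; concatMap; upTo; applyUpTo)
open import Data.Bool using (Bool; true; false; _∧_; if_then_else_)
open import Relation.Binary.PropositionalEquality using (_≡_)

FPS : Set
FPS = ℕ → ℤ

_≋_ : FPS → FPS → Set
f ≋ g = ∀ n → f n ≡ g n

infix 4 _≋_

sumOver : {A : Set} → List A → (A → ℤ) → ℤ
sumOver []       f = 0ℤ
sumOver (x ∷ xs) f = f x ℤ.+ sumOver xs f

𝟙 : FPS
𝟙 n = if n ≡ᵇ 0 then 1ℤ else 0ℤ

𝕢 : FPS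
𝕢 n = if n ≡ᵇ 1 then 1ℤ else 0ℤ

_⊕_ : FPS → FPS → FPS
(f ⊕ g) n = f n ℤ.+ g n

⊝_ : FPS → FPS
(⊝ f) n = ℤ.- (f n)

_⊖_ : FPS → FPS → FPS
f ⊖ g = f ⊕ (⊝ g)

_⊛_ : FPS → FPS → FPS
(f ⊛ g) n = sumOver (upTo (suc n)) (λ i → f i ℤ.* g (n ∸ i))

infixl 7 _⊛_
infixl 6 _⊕_ _⊖_

_^^_ : FPS → ℕ → FPS
f ^^ zero    = 𝟙
f ^^ (suc k) = f ⊛ (f ^^ k)

-- q-Pochhammer symbol (a;b)_l = ∏_{i=0}^{l-1} (1 - a b^i)
poch : FPS → FPS → ℕ → FPS
poch a b zero    = 𝟙
poch a b (suc l) = poch a b l ⊛ (𝟙 ⊖ a ⊛ (b ^^ l))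

-- Partitions, represented as lists λ₁ ∷ λ₂ ∷ … (first entry largest)

mutual
  𝒪 : List ℕ → ℕ
  𝒪 []       = 0
  𝒪 (x ∷ xs) = x + ℰ xs

  ℰ : List ℕ → ℕ
  ℰ []       = 0
  ℰ (x ∷ xs) = 𝒪 xs

allIn : ℕ → List ℕ → Bool
allIn N []       = true
allIn N (x ∷ xs) = (1 ≤ᵇ x) ∧ (x ≤ᵇ N) ∧ allIn N xs

nonIncreasing : List ℕ → Bool
nonIncreasing []           = true
nonIncreasing (x ∷ [])     = true
nonIncreasing (x ∷ y ∷ xs) = (y ≤ᵇ x) ∧ nonIncreasing (y ∷ xs)

strictlyDecreasing : List ℕ → Bool
strictlyDecreasing []           = true
strictlyDecreasing (x ∷ [])     = true
strictlyDecreasing (x ∷ y ∷ xs) = (y <ᵇ x) ∧ strictlyDecreasing (y ∷ xs)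

inP≤ : ℕ → List ℕ → Bool
inP≤ N π = allIn N π ∧ nonIncreasing π

inD≤ : ℕ → List ℕ → Bool
inD≤ N π = allIn N π ∧ strictlyDecreasing π

listsOfLength : ℕ → ℕ → List (List ℕ)
listsOfLength N zero    = [] ∷ []
listsOfLength N (suc ℓ) =
  concatMap (λ x → map (x ∷_) (listsOfLength N ℓ)) (upTo (suc N))

candidates : ℕ → ℕ → List (List ℕ)
candidates N L = concatMap (listsOfLength N) (upTo (suc L))

sgn : ℕ → ℤ
sgn e = -1ℤ ℤ.^ e

-- Σ_{π ∈ 𝒟_{≤N}} (-1)^{ℰ(π)} q^{𝒪(π)}  (a polynomial; a partition into
-- distinct parts ≤ N has at most N parts)
genD : ℕ → FPS
genD N n = sumOver (candidates N N)
  (λ π → if inD≤ N π ∧ (𝒪 π ≡ᵇ n) then sgn (ℰ π) else 0ℤ)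

-- Σ_{π ∈ 𝒫_{≤N}} (-1)^{ℰ(π)} q^{𝒪(π)}.  The coefficient of qⁿ is a finite
-- sum: if 𝒪(π) = n then |π| ≤ 2n, so π has at most 2n parts.
genP : ℕ → FPS
genP N n = sumOver (candidates N (2 * n))
  (λ π → if inP≤ N π ∧ (𝒪 π ≡ᵇ n) then sgn (ℰ π) else 0ℤ)

-- Write G_c = Σ (-1)^ℰ q^𝒪 and H_c = Σ (-1)^𝒪 q^ℰ over the partitions with parts ≤ c
-- (distinct parts in the 𝒟 case).  Removing the largest part c+1 exchanges odd- and
-- even-indexed parts, so
--   G_{c+1} = G_c + q^{c+1} H′,   H_{c+1} = H_c + (-1)^{c+1} G′,
-- where (G′, H′) = (G_c, H_c) for distinct parts and (G_{c+1}, H_{c+1}) otherwise.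
-- For distinct parts this solves by induction to G_{2m} = H_{2m} = (-q;q²)_m,
-- G_{2m+1} = (-q;q²)_{m+1}, H_{2m+1} = 0.  For arbitrary parts the odd step gives
-- (1 + q^{2m+1}) H_{2m+1} = 0, hence H_{2m+1} = 0 and G_{2m+1} = G_{2m}; the even
-- step then gives (1 - q^{2m+2}) G_{2m+2} = G_{2m}, so G_{2m} (q²;q²)_m = 1.
{-# OPTIONS --safe #-}
module Submission where

open import Defs
open import Data.Bool using (Bool; true; false; _∧_; if_then_else_)
open import Data.Bool.Properties using (∧-zeroʳ)
open import Data.Empty using (⊥-elim)
open import Data.Integer using (ℤ; 0ℤ; 1ℤ; -1ℤ; _+_; _*_; -_)
import Data.Integer.Properties as ℤₚ
open import Data.Integer.Tactic.RingSolver using (solve-∀)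
open import Data.List using (List; []; _∷_; map; concatMap; upTo; applyUpTo; _++_; length)
open import Data.List.Relation.Unary.All using (All; []; _∷_)
open import Data.Nat as ℕ using (ℕ; zero; suc; _∸_; _≤_; _<_; z≤n; s≤s; _<ᵇ_; _≡ᵇ_; ⌈_/2⌉; ⌊_/2⌋)
import Data.Nat.Properties as ℕₚ
open import Data.Nat.Induction using (<-rec)
open import Data.Product using (_×_; _,_; proj₁; proj₂; ∃)
open import Data.Sum using (_⊎_; inj₁; inj₂)
open import Relation.Binary.PropositionalEquality
import Relation.Binary.Reasoning.Setoid as SetoidReasoning

module ≋-Reasoning = SetoidReasoning (ℕ →-setoid ℤ)

sumBelow : ℕ → (ℕ → ℤ) → ℤ
sumBelow zero    f = 0ℤ
sumBelow (suc n) f = f 0 + sumBelow n (λ i → f (suc i))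

sumBelow-cong : ∀ n {f g : ℕ → ℤ} → (∀ i → i < n → f i ≡ g i) → sumBelow n f ≡ sumBelow n g
sumBelow-cong zero    eq = refl
sumBelow-cong (suc n) eq =
  cong₂ _+_ (eq 0 (s≤s z≤n)) (sumBelow-cong n (λ i i<n → eq (suc i) (s≤s i<n)))

sumBelow-zero : ∀ n {f : ℕ → ℤ} → (∀ i → i < n → f i ≡ 0ℤ) → sumBelow n f ≡ 0ℤ
sumBelow-zero zero    eq = refl
sumBelow-zero (suc n) eq =
  cong₂ _+_ (eq 0 (s≤s z≤n)) (sumBelow-zero n (λ i i<n → eq (suc i) (s≤s i<n)))

sumBelow-+ : ∀ n (f g : ℕ → ℤ) → sumBelow n (λ i → f i + g i) ≡ sumBelow n f + sumBelow n g
sumBelow-+ zero    f g = refl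
sumBelow-+ (suc n) f g = trans (cong (f 0 + g 0 +_) (sumBelow-+ n _ _)) (interchange (f 0) (g 0) _ _)
  where
  interchange : ∀ a b c d → (a + b) + (c + d) ≡ (a + c) + (b + d)
  interchange = solve-∀

sumBelow-*ˡ : ∀ n k (f : ℕ → ℤ) → sumBelow n (λ i → k * f i) ≡ k * sumBelow n f
sumBelow-*ˡ zero    k f = sym (ℤₚ.*-zeroʳ k)
sumBelow-*ˡ (suc n) k f = trans (cong (k * f 0 +_) (sumBelow-*ˡ n k _)) (sym (ℤₚ.*-distribˡ-+ k _ _))

sumBelow-neg : ∀ n (f : ℕ → ℤ) → sumBelow n (λ i → - f i) ≡ - sumBelow n f
sumBelow-neg zero    f = refl
sumBelow-neg (suc n) f = trans (cong (- f 0 +_) (sumBelow-neg n _)) (sym (ℤₚ.neg-distrib-+ (f 0) _))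

sumBelow-snoc : ∀ n (f : ℕ → ℤ) → sumBelow (suc n) f ≡ sumBelow n f + f n
sumBelow-snoc zero    f = trans (ℤₚ.+-identityʳ (f 0)) (sym (ℤₚ.+-identityˡ (f 0)))
sumBelow-snoc (suc n) f = trans (cong (f 0 +_) (sumBelow-snoc n _)) (sym (ℤₚ.+-assoc (f 0) _ _))

sumBelow-truncate : ∀ c n {f g : ℕ → ℤ} → c ≤ n → (∀ i → i < c → f i ≡ g i) →
                    (∀ i → c ≤ i → i < n → f i ≡ 0ℤ) → sumBelow n f ≡ sumBelow c g
sumBelow-truncate zero    n       c≤n       eq vanish = sumBelow-zero n (λ i → vanish i z≤n)
sumBelow-truncate (suc c) (suc n) (s≤s c≤n) eq vanish = cong₂ _+_ (eq 0 (s≤s z≤n))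
  (sumBelow-truncate c n c≤n (λ i i<c → eq (suc i) (s≤s i<c))
                             (λ i c≤i i<n → vanish (suc i) (s≤s c≤i) (s≤s i<n)))

sumBelow-reverse : ∀ n (f : ℕ → ℤ) → sumBelow (suc n) (λ i → f (n ∸ i)) ≡ sumBelow (suc n) f
sumBelow-reverse zero    f = refl
sumBelow-reverse (suc n) f = begin
  f (suc n) + sumBelow (suc n) (λ i → f (n ∸ i))  ≡⟨ cong (f (suc n) +_) (sumBelow-reverse n f) ⟩
  f (suc n) + sumBelow (suc n) f                  ≡⟨ ℤₚ.+-comm (f (suc n)) _ ⟩
  sumBelow (suc n) f + f (suc n)                  ≡⟨ sumBelow-snoc (suc n) f ⟨
  sumBelow (suc (suc n)) f                        ∎
  where open ≡-Reasoning

sumOver-cong : ∀ {A : Set} (xs : List A) {f g : A → ℤ} → (∀ x → f x ≡ g x) →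
               sumOver xs f ≡ sumOver xs g
sumOver-cong []       eq = refl
sumOver-cong (x ∷ xs) eq = cong₂ _+_ (eq x) (sumOver-cong xs eq)

sumOver-zero : ∀ {A : Set} (xs : List A) → sumOver xs (λ _ → 0ℤ) ≡ 0ℤ
sumOver-zero []       = refl
sumOver-zero (x ∷ xs) = trans (ℤₚ.+-identityˡ _) (sumOver-zero xs)

sumOver-applyUpTo : ∀ {A : Set} n (f : ℕ → A) (h : A → ℤ) →
                    sumOver (applyUpTo f n) h ≡ sumBelow n (λ i → h (f i))
sumOver-applyUpTo zero    f h = refl
sumOver-applyUpTo (suc n) f h = cong (h (f 0) +_) (sumOver-applyUpTo n (λ i → f (suc i)) h)

sumOver-++ : ∀ {A : Set} (xs ys : List A) (h : A → ℤ) →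
             sumOver (xs ++ ys) h ≡ sumOver xs h + sumOver ys h
sumOver-++ []       ys h = sym (ℤₚ.+-identityˡ _)
sumOver-++ (x ∷ xs) ys h = trans (cong (h x +_) (sumOver-++ xs ys h)) (sym (ℤₚ.+-assoc (h x) _ _))

sumOver-map : ∀ {A B : Set} (k : A → B) (xs : List A) (h : B → ℤ) →
              sumOver (map k xs) h ≡ sumOver xs (λ x → h (k x))
sumOver-map k []       h = refl
sumOver-map k (x ∷ xs) h = cong (h (k x) +_) (sumOver-map k xs h)

sumOver-concatMap : ∀ {A B : Set} (k : A → List B) (xs : List A) (h : B → ℤ) →
                    sumOver (concatMap k xs) h ≡ sumOver xs (λ x → sumOver (k x) h)
sumOver-concatMap k []       h = refl
sumOver-concatMap k (x ∷ xs) h =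
  trans (sumOver-++ (k x) (concatMap k xs) h) (cong (sumOver (k x) h +_) (sumOver-concatMap k xs h))

𝟘 : FPS
𝟘 _ = 0ℤ

⊕-cong : ∀ {f f′ g g′} → f ≋ f′ → g ≋ g′ → f ⊕ g ≋ f′ ⊕ g′
⊕-cong eq eq′ n = cong₂ _+_ (eq n) (eq′ n)

⊝-cong : ∀ {f g} → f ≋ g → ⊝ f ≋ ⊝ g
⊝-cong eq n = cong -_ (eq n)

⊛-as-sumBelow : ∀ f g n → (f ⊛ g) n ≡ sumBelow (suc n) (λ i → f i * g (n ∸ i))
⊛-as-sumBelow f g n = sumOver-applyUpTo (suc n) (λ i → i) (λ i → f i * g (n ∸ i))

⊛-congˡ : ∀ {f f′} g → f ≋ f′ → f ⊛ g ≋ f′ ⊛ g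
⊛-congˡ g eq n = sumOver-cong (upTo (suc n)) (λ i → cong (_* g (n ∸ i)) (eq i))

⊛-congʳ : ∀ f {g g′} → g ≋ g′ → f ⊛ g ≋ f ⊛ g′
⊛-congʳ f eq n = sumOver-cong (upTo (suc n)) (λ i → cong (f i *_) (eq (n ∸ i)))

⊛-comm : ∀ f g → f ⊛ g ≋ g ⊛ f
⊛-comm f g n = begin
  (f ⊛ g) n                                            ≡⟨ ⊛-as-sumBelow f g n ⟩
  sumBelow (suc n) (λ i → f i * g (n ∸ i))             ≡⟨ sumBelow-reverse n (λ i → f i * g (n ∸ i)) ⟨
  sumBelow (suc n) (λ i → f (n ∸ i) * g (n ∸ (n ∸ i))) ≡⟨ sumBelow-cong (suc n) swap ⟩
  sumBelow (suc n) (λ i → g i * f (n ∸ i))             ≡⟨ ⊛-as-sumBelow g f n ⟨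
  (g ⊛ f) n                                            ∎
  where
  open ≡-Reasoning
  swap : ∀ i → i < suc n → f (n ∸ i) * g (n ∸ (n ∸ i)) ≡ g i * f (n ∸ i)
  swap i i≤n = trans (cong (λ j → f (n ∸ i) * g j) (ℕₚ.m∸[m∸n]≡n (ℕₚ.≤-pred i≤n)))
                     (ℤₚ.*-comm (f (n ∸ i)) (g i))

⊛-identityˡ : ∀ f → 𝟙 ⊛ f ≋ f
⊛-identityˡ f n = begin
  (𝟙 ⊛ f) n
    ≡⟨ ⊛-as-sumBelow 𝟙 f n ⟩
  1ℤ * f n + sumBelow n (λ i → 0ℤ * f (n ∸ suc i))
    ≡⟨ cong₂ _+_ (ℤₚ.*-identityˡ (f n)) (sumBelow-zero n (λ i _ → ℤₚ.*-zeroˡ (f (n ∸ suc i)))) ⟩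
  f n + 0ℤ
    ≡⟨ ℤₚ.+-identityʳ (f n) ⟩
  f n
    ∎
  where open ≡-Reasoning

⊛-identityʳ : ∀ f → f ⊛ 𝟙 ≋ f
⊛-identityʳ f n = trans (⊛-comm f 𝟙 n) (⊛-identityˡ f n)

⊛-distribˡ-⊕ : ∀ f g h → f ⊛ (g ⊕ h) ≋ f ⊛ g ⊕ f ⊛ h
⊛-distribˡ-⊕ f g h n = begin
  (f ⊛ (g ⊕ h)) n
    ≡⟨ ⊛-as-sumBelow f (g ⊕ h) n ⟩
  sumBelow (suc n) (λ i → f i * (g (n ∸ i) + h (n ∸ i)))
    ≡⟨ sumBelow-cong (suc n) (λ i _ → ℤₚ.*-distribˡ-+ (f i) (g (n ∸ i)) (h (n ∸ i))) ⟩
  sumBelow (suc n) (λ i → f i * g (n ∸ i) + f i * h (n ∸ i))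
    ≡⟨ sumBelow-+ (suc n) (λ i → f i * g (n ∸ i)) (λ i → f i * h (n ∸ i)) ⟩
  sumBelow (suc n) (λ i → f i * g (n ∸ i)) + sumBelow (suc n) (λ i → f i * h (n ∸ i))
    ≡⟨ cong₂ _+_ (⊛-as-sumBelow f g n) (⊛-as-sumBelow f h n) ⟨
  (f ⊛ g ⊕ f ⊛ h) n
    ∎
  where open ≡-Reasoning

⊛-negʳ : ∀ f g → f ⊛ (⊝ g) ≋ ⊝ (f ⊛ g)
⊛-negʳ f g n = begin
  (f ⊛ (⊝ g)) n
    ≡⟨ ⊛-as-sumBelow f (⊝ g) n ⟩
  sumBelow (suc n) (λ i → f i * - g (n ∸ i))
    ≡⟨ sumBelow-cong (suc n) (λ i _ → sym (ℤₚ.neg-distribʳ-* (f i) (g (n ∸ i)))) ⟩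
  sumBelow (suc n) (λ i → - (f i * g (n ∸ i)))
    ≡⟨ sumBelow-neg (suc n) (λ i → f i * g (n ∸ i)) ⟩
  - sumBelow (suc n) (λ i → f i * g (n ∸ i))
    ≡⟨ cong -_ (⊛-as-sumBelow f g n) ⟨
  (⊝ (f ⊛ g)) n
    ∎
  where open ≡-Reasoning

⊛-distribˡ-⊖ : ∀ f g h → f ⊛ (g ⊖ h) ≋ f ⊛ g ⊖ f ⊛ h
⊛-distribˡ-⊖ f g h n = trans (⊛-distribˡ-⊕ f g (⊝ h) n) (cong ((f ⊛ g) n +_) (⊛-negʳ f h n))

shift : ℕ → FPS → FPS
shift zero    f n       = f n
shift (suc k) f zero    = 0ℤ
shift (suc k) f (suc n) = shift k f n

shift-cong : ∀ k {f g} → f ≋ g → shift k f ≋ shift k g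
shift-cong zero    eq n       = eq n
shift-cong (suc k) eq zero    = refl
shift-cong (suc k) eq (suc n) = shift-cong k eq n

shift-congᵗ : ∀ k n {f g : FPS} → (∀ m → m ℕ.+ k ≡ n → f m ≡ g m) → shift k f n ≡ shift k g n
shift-congᵗ zero    n       eq = eq n (ℕₚ.+-identityʳ n)
shift-congᵗ (suc k) zero    eq = refl
shift-congᵗ (suc k) (suc n) eq = shift-congᵗ k n (λ m e → eq m (trans (ℕₚ.+-suc m k) (cong suc e)))

shift-≡ : ∀ {j k} f → j ≡ k → shift j f ≋ shift k f
shift-≡ f refl n = refl

shift-suc : ∀ k f → shift (suc k) f ≋ shift 1 (shift k f)
shift-suc k f zero    = refl
shift-suc k f (suc n) = refl

shift-+ : ∀ j k f → shift j (shift k f) ≋ shift (j ℕ.+ k) f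
shift-+ zero    k f n       = refl
shift-+ (suc j) k f zero    = refl
shift-+ (suc j) k f (suc n) = shift-+ j k f n

shift-neg : ∀ k f → shift k (⊝ f) ≋ ⊝ shift k f
shift-neg zero    f n       = refl
shift-neg (suc k) f zero    = refl
shift-neg (suc k) f (suc n) = shift-neg k f n

shift-𝟘 : ∀ k → shift k 𝟘 ≋ 𝟘
shift-𝟘 zero    n       = refl
shift-𝟘 (suc k) zero    = refl
shift-𝟘 (suc k) (suc n) = shift-𝟘 k n

shift-vanishes : ∀ k n (f : FPS) → (∀ j → j < n → f j ≡ 0ℤ) → shift (suc k) f n ≡ 0ℤ
shift-vanishes k       zero    f small = refl
shift-vanishes zero    (suc n) f small = small n (ℕₚ.n<1+n n)
shift-vanishes (suc k) (suc n) f small = shift-vanishes k n f (λ j j<n → small j (ℕₚ.m<n⇒m<1+n j<n))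

⊛-shift₁ : ∀ f g → f ⊛ shift 1 g ≋ shift 1 (f ⊛ g)
⊛-shift₁ f g zero    = cong (_+ 0ℤ) (ℤₚ.*-zeroʳ (f 0))
⊛-shift₁ f g (suc m) = begin
  (f ⊛ shift 1 g) (suc m)
    ≡⟨ ⊛-as-sumBelow f (shift 1 g) (suc m) ⟩
  sumBelow (suc (suc m)) (λ i → f i * shift 1 g (suc m ∸ i))
    ≡⟨ sumBelow-snoc (suc m) (λ i → f i * shift 1 g (suc m ∸ i)) ⟩
  sumBelow (suc m) (λ i → f i * shift 1 g (suc m ∸ i)) + f (suc m) * shift 1 g (suc m ∸ suc m)
    ≡⟨ cong₂ _+_ (sumBelow-cong (suc m) unshift) last ⟩
  sumBelow (suc m) (λ i → f i * g (m ∸ i)) + 0ℤ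
    ≡⟨ ℤₚ.+-identityʳ _ ⟩
  sumBelow (suc m) (λ i → f i * g (m ∸ i))
    ≡⟨ ⊛-as-sumBelow f g m ⟨
  shift 1 (f ⊛ g) (suc m)
    ∎
  where
  open ≡-Reasoning
  unshift : ∀ i → i < suc m → f i * shift 1 g (suc m ∸ i) ≡ f i * g (m ∸ i)
  unshift i i≤m = cong (λ j → f i * shift 1 g j) (ℕₚ.+-∸-assoc 1 (ℕₚ.≤-pred i≤m))
  last : f (suc m) * shift 1 g (suc m ∸ suc m) ≡ 0ℤ
  last = trans (cong (λ j → f (suc m) * shift 1 g j) (ℕₚ.n∸n≡0 m)) (ℤₚ.*-zeroʳ (f (suc m)))

⊛-shift : ∀ k f g → f ⊛ shift k g ≋ shift k (f ⊛ g)
⊛-shift zero    f g n = refl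
⊛-shift (suc k) f g = begin
  f ⊛ shift (suc k) g          ≈⟨ ⊛-congʳ f (shift-suc k g) ⟩
  f ⊛ shift 1 (shift k g)      ≈⟨ ⊛-shift₁ f (shift k g) ⟩
  shift 1 (f ⊛ shift k g)      ≈⟨ shift-cong 1 (⊛-shift k f g) ⟩
  shift 1 (shift k (f ⊛ g))    ≈⟨ shift-suc k (f ⊛ g) ⟨
  shift (suc k) (f ⊛ g)        ∎
  where open ≋-Reasoning

⊛-shift-𝟙 : ∀ k f → f ⊛ shift k 𝟙 ≋ shift k f
⊛-shift-𝟙 k f n = trans (⊛-shift k f 𝟙 n) (shift-cong k (⊛-identityʳ f) n)

⊛-⊖-shift : ∀ k f g → f ⊛ (g ⊖ shift k g) ≋ f ⊛ g ⊖ shift k (f ⊛ g)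
⊛-⊖-shift k f g n =
  trans (⊛-distribˡ-⊖ f g (shift k g) n) (cong (λ x → (f ⊛ g) n + - x) (⊛-shift k f g n))

⊛-⊖-shift-swap : ∀ k f g → f ⊛ (g ⊖ shift k g) ≋ (f ⊖ shift k f) ⊛ g
⊛-⊖-shift-swap k f g = begin
  f ⊛ (g ⊖ shift k g)        ≈⟨ ⊛-⊖-shift k f g ⟩
  f ⊛ g ⊖ shift k (f ⊛ g)    ≈⟨ ⊕-cong (⊛-comm f g) (⊝-cong (shift-cong k (⊛-comm f g))) ⟩
  g ⊛ f ⊖ shift k (g ⊛ f)    ≈⟨ ⊛-⊖-shift k g f ⟨
  g ⊛ (f ⊖ shift k f)        ≈⟨ ⊛-comm g (f ⊖ shift k f) ⟩
  (f ⊖ shift k f) ⊛ g        ∎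
  where open ≋-Reasoning

-- The coefficient of qⁿ in q^(k+1) h only involves lower coefficients of h.
⊕-shift≋𝟘⇒≋𝟘 : ∀ k h → h ⊕ shift (suc k) h ≋ 𝟘 → h ≋ 𝟘
⊕-shift≋𝟘⇒≋𝟘 k h sum≋𝟘 = <-rec (λ n → h n ≡ 0ℤ) step
  where
  step : ∀ n → (∀ {j} → j < n → h j ≡ 0ℤ) → h n ≡ 0ℤ
  step n lower = begin
    h n                       ≡⟨ ℤₚ.+-identityʳ (h n) ⟨
    h n + 0ℤ                  ≡⟨ cong (h n +_) (shift-vanishes k n h (λ j → lower)) ⟨
    h n + shift (suc k) h n   ≡⟨ sum≋𝟘 n ⟩
    0ℤ                        ∎
    where open ≡-Reasoning

𝕢≋shift : 𝕢 ≋ shift 1 𝟙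
𝕢≋shift zero    = refl
𝕢≋shift (suc n) = refl

shift-𝕢 : ∀ k → shift k 𝕢 ≋ shift (suc k) 𝟙
shift-𝕢 k = begin
  shift k 𝕢                ≈⟨ shift-cong k 𝕢≋shift ⟩
  shift k (shift 1 𝟙)      ≈⟨ shift-+ k 1 𝟙 ⟩
  shift (k ℕ.+ 1) 𝟙        ≈⟨ shift-≡ 𝟙 (ℕₚ.+-comm k 1) ⟩
  shift (suc k) 𝟙          ∎
  where open ≋-Reasoning

𝕢^^≋shift : ∀ k → 𝕢 ^^ k ≋ shift k 𝟙
𝕢^^≋shift zero    n = refl
𝕢^^≋shift (suc k) = begin
  𝕢 ⊛ 𝕢 ^^ k         ≈⟨ ⊛-congʳ 𝕢 (𝕢^^≋shift k) ⟩
  𝕢 ⊛ shift k 𝟙      ≈⟨ ⊛-shift-𝟙 k 𝕢 ⟩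
  shift k 𝕢          ≈⟨ shift-𝕢 k ⟩
  shift (suc k) 𝟙    ∎
  where open ≋-Reasoning

𝕢²^^≋shift : ∀ m → (𝕢 ^^ 2) ^^ m ≋ shift (m ℕ.+ m) 𝟙
𝕢²^^≋shift zero    n = refl
𝕢²^^≋shift (suc m) = begin
  𝕢 ^^ 2 ⊛ (𝕢 ^^ 2) ^^ m        ≈⟨ ⊛-congʳ (𝕢 ^^ 2) (𝕢²^^≋shift m) ⟩
  𝕢 ^^ 2 ⊛ shift (m ℕ.+ m) 𝟙    ≈⟨ ⊛-shift-𝟙 (m ℕ.+ m) (𝕢 ^^ 2) ⟩
  shift (m ℕ.+ m) (𝕢 ^^ 2)      ≈⟨ shift-cong (m ℕ.+ m) (𝕢^^≋shift 2) ⟩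
  shift (m ℕ.+ m) (shift 2 𝟙)   ≈⟨ shift-+ (m ℕ.+ m) 2 𝟙 ⟩
  shift (m ℕ.+ m ℕ.+ 2) 𝟙       ≈⟨ shift-≡ 𝟙 index ⟩
  shift (suc m ℕ.+ suc m) 𝟙     ∎
  where
  open ≋-Reasoning
  index : m ℕ.+ m ℕ.+ 2 ≡ suc m ℕ.+ suc m
  index = trans (ℕₚ.+-comm (m ℕ.+ m) 2) (cong suc (sym (ℕₚ.+-suc m m)))

Pᴰ Pᴾ : ℕ → FPS
Pᴰ = poch (⊝ 𝕢) (𝕢 ^^ 2)
Pᴾ = poch (𝕢 ^^ 2) (𝕢 ^^ 2)

Pᴰ-suc : ∀ m → Pᴰ (suc m) ≋ Pᴰ m ⊕ shift (suc (m ℕ.+ m)) (Pᴰ m)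
Pᴰ-suc m = begin
  Pᴰ m ⊛ (𝟙 ⊖ (⊝ 𝕢) ⊛ ((𝕢 ^^ 2) ^^ m))
    ≈⟨ ⊛-congʳ (Pᴰ m) (⊕-cong {𝟙} (λ _ → refl) factor) ⟩
  Pᴰ m ⊛ (𝟙 ⊕ shift k 𝟙)
    ≈⟨ ⊛-distribˡ-⊕ (Pᴰ m) 𝟙 (shift k 𝟙) ⟩
  Pᴰ m ⊛ 𝟙 ⊕ Pᴰ m ⊛ shift k 𝟙
    ≈⟨ ⊕-cong (⊛-identityʳ (Pᴰ m)) (⊛-shift-𝟙 k (Pᴰ m)) ⟩
  Pᴰ m ⊕ shift k (Pᴰ m)
    ∎
  where
  open ≋-Reasoning
  k = suc (m ℕ.+ m)
  factor : ⊝ ((⊝ 𝕢) ⊛ ((𝕢 ^^ 2) ^^ m)) ≋ shift k 𝟙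
  factor = begin
    ⊝ ((⊝ 𝕢) ⊛ ((𝕢 ^^ 2) ^^ m))     ≈⟨ ⊝-cong (⊛-congʳ (⊝ 𝕢) (𝕢²^^≋shift m)) ⟩
    ⊝ ((⊝ 𝕢) ⊛ shift (m ℕ.+ m) 𝟙)   ≈⟨ ⊝-cong (⊛-shift-𝟙 (m ℕ.+ m) (⊝ 𝕢)) ⟩
    ⊝ shift (m ℕ.+ m) (⊝ 𝕢)         ≈⟨ ⊝-cong (shift-neg (m ℕ.+ m) 𝕢) ⟩
    ⊝ ⊝ shift (m ℕ.+ m) 𝕢           ≈⟨ (λ n → ℤₚ.neg-involutive _) ⟩
    shift (m ℕ.+ m) 𝕢               ≈⟨ shift-𝕢 (m ℕ.+ m) ⟩
    shift k 𝟙                       ∎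

Pᴾ-suc : ∀ m → Pᴾ (suc m) ≋ Pᴾ m ⊖ shift (suc (suc (m ℕ.+ m))) (Pᴾ m)
Pᴾ-suc m = begin
  Pᴾ m ⊛ (𝟙 ⊖ (𝕢 ^^ 2) ⊛ ((𝕢 ^^ 2) ^^ m))
    ≈⟨ ⊛-congʳ (Pᴾ m) (⊕-cong {𝟙} (λ _ → refl) (⊝-cong factor)) ⟩
  Pᴾ m ⊛ (𝟙 ⊖ shift k 𝟙)
    ≈⟨ ⊛-distribˡ-⊖ (Pᴾ m) 𝟙 (shift k 𝟙) ⟩
  Pᴾ m ⊛ 𝟙 ⊖ Pᴾ m ⊛ shift k 𝟙
    ≈⟨ ⊕-cong (⊛-identityʳ (Pᴾ m)) (⊝-cong (⊛-shift-𝟙 k (Pᴾ m))) ⟩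
  Pᴾ m ⊖ shift k (Pᴾ m)
    ∎
  where
  open ≋-Reasoning
  k = suc (suc (m ℕ.+ m))
  factor : (𝕢 ^^ 2) ⊛ ((𝕢 ^^ 2) ^^ m) ≋ shift k 𝟙
  factor n = trans (𝕢²^^≋shift (suc m) n) (shift-≡ 𝟙 (cong suc (ℕₚ.+-suc m m)) n)

<ᵇ-true : ∀ {i n} → i < n → (i <ᵇ n) ≡ true
<ᵇ-true {zero}  {suc n} _         = refl
<ᵇ-true {suc i} {suc n} (s≤s i<n) = <ᵇ-true i<n

<ᵇ-false : ∀ {i n} → n ≤ i → (i <ᵇ n) ≡ false
<ᵇ-false {i}     {zero}  _         = refl
<ᵇ-false {suc i} {suc n} (s≤s n≤i) = <ᵇ-false n≤i

sumOver-listsOfLength-suc : ∀ N ℓ (F : List ℕ → ℤ) → sumOver (listsOfLength N (suc ℓ)) F ≡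
  sumBelow (suc N) (λ x → sumOver (listsOfLength N ℓ) (λ xs → F (x ∷ xs)))
sumOver-listsOfLength-suc N ℓ F = begin
  sumOver (concatMap (λ x → map (x ∷_) (listsOfLength N ℓ)) (upTo (suc N))) F
    ≡⟨ sumOver-concatMap (λ x → map (x ∷_) (listsOfLength N ℓ)) (upTo (suc N)) F ⟩
  sumOver (upTo (suc N)) (λ x → sumOver (map (x ∷_) (listsOfLength N ℓ)) F)
    ≡⟨ sumOver-applyUpTo (suc N) (λ x → x) (λ x → sumOver (map (x ∷_) (listsOfLength N ℓ)) F) ⟩
  sumBelow (suc N) (λ x → sumOver (map (x ∷_) (listsOfLength N ℓ)) F)
    ≡⟨ sumBelow-cong (suc N) (λ x _ → sumOver-map (x ∷_) (listsOfLength N ℓ) F) ⟩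
  sumBelow (suc N) (λ x → sumOver (listsOfLength N ℓ) (λ xs → F (x ∷ xs)))
    ∎
  where open ≡-Reasoning

oddWeight evenWeight : ℕ → List ℕ → ℤ
oddWeight  n π = if 𝒪 π ≡ᵇ n then sgn (ℰ π) else 0ℤ
evenWeight n π = if ℰ π ≡ᵇ n then sgn (𝒪 π) else 0ℤ

evenWeight-∷ : ∀ n x π → evenWeight n (x ∷ π) ≡ sgn x * oddWeight n π
evenWeight-∷ n x π with 𝒪 π ≡ᵇ n
... | true  = ℤₚ.^-distribˡ-+-* -1ℤ x (ℰ π)
... | false = sym (ℤₚ.*-zeroʳ (sgn x))

weight-[] : ∀ n → (if 0 ≡ᵇ n then sgn 0 else 0ℤ) ≡ 𝟙 n
weight-[] zero    = refl
weight-[] (suc n) = refl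

-- partitionSum ℓ c g sums g over the partitions of length ℓ with parts ≤ c, enumerated by
-- their largest part suc i, after which only parts ≤ tail i may follow: tail i = i gives
-- the partitions into distinct parts, tail i = suc i all partitions.
module _ (tail : ℕ → ℕ) where

  partitionSum : ℕ → ℕ → (List ℕ → ℤ) → ℤ
  partitionSum zero    c g = g []
  partitionSum (suc ℓ) c g = sumBelow c (λ i → partitionSum ℓ (tail i) (λ π → g (suc i ∷ π)))

  partitionSum≤ : ℕ → ℕ → (List ℕ → ℤ) → ℤ
  partitionSum≤ L c g = sumBelow (suc L) (λ ℓ → partitionSum ℓ c g)

  fits : ℕ → List ℕ → Bool
  fits c []       = true
  fits c (x ∷ xs) = (1 ℕ.≤ᵇ x) ∧ (x ℕ.≤ᵇ c) ∧ fits (tail (ℕ.pred x)) xs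

  partitionSum-cong : ∀ ℓ c {g h : List ℕ → ℤ} → (∀ π → g π ≡ h π) →
                      partitionSum ℓ c g ≡ partitionSum ℓ c h
  partitionSum-cong zero    c eq = eq []
  partitionSum-cong (suc ℓ) c eq =
    sumBelow-cong c (λ i _ → partitionSum-cong ℓ (tail i) (λ π → eq (suc i ∷ π)))

  partitionSum-*ˡ : ∀ ℓ c k g → partitionSum ℓ c (λ π → k * g π) ≡ k * partitionSum ℓ c g
  partitionSum-*ˡ zero    c k g = refl
  partitionSum-*ˡ (suc ℓ) c k g = trans
    (sumBelow-cong c (λ i _ → partitionSum-*ˡ ℓ (tail i) k (λ π → g (suc i ∷ π))))
    (sumBelow-*ˡ c k (λ i → partitionSum ℓ (tail i) (λ π → g (suc i ∷ π))))

  partitionSum-vanishes : ∀ ℓ c {g : List ℕ → ℤ} →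
    (∀ π → All (1 ≤_) π → length π ≡ ℓ → g π ≡ 0ℤ) → partitionSum ℓ c g ≡ 0ℤ
  partitionSum-vanishes zero    c vanish = vanish [] [] refl
  partitionSum-vanishes (suc ℓ) c vanish = sumBelow-zero c (λ i _ → partitionSum-vanishes ℓ (tail i)
    (λ π pos len → vanish (suc i ∷ π) (s≤s z≤n ∷ pos) (cong suc len)))

  partitionSum≤-cong : ∀ L c {g h : List ℕ → ℤ} → (∀ π → g π ≡ h π) →
                       partitionSum≤ L c g ≡ partitionSum≤ L c h
  partitionSum≤-cong L c eq = sumBelow-cong (suc L) (λ ℓ _ → partitionSum-cong ℓ c eq)

  partitionSum≤-*ˡ : ∀ L c k g → partitionSum≤ L c (λ π → k * g π) ≡ k * partitionSum≤ L c g
  partitionSum≤-*ˡ L c k g = trans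
    (sumBelow-cong (suc L) (λ ℓ _ → partitionSum-*ˡ ℓ c k g))
    (sumBelow-*ˡ (suc L) k (λ ℓ → partitionSum ℓ c g))

  partitionSum≤-𝟘 : ∀ L c → partitionSum≤ L c (λ _ → 0ℤ) ≡ 0ℤ
  partitionSum≤-𝟘 L c = sumBelow-zero (suc L) (λ ℓ _ → partitionSum-vanishes ℓ c (λ _ _ _ → refl))

  partitionSum≤-0 : ∀ L g → partitionSum≤ L 0 g ≡ g []
  partitionSum≤-0 L g = trans (cong (g [] +_) (sumBelow-zero L (λ _ _ → refl))) (ℤₚ.+-identityʳ (g []))

  partitionSum≤-extend : ∀ {L L′ c g} → L ≤ L′ → (∀ ℓ → L < ℓ → partitionSum ℓ c g ≡ 0ℤ) →
                         partitionSum≤ L′ c g ≡ partitionSum≤ L c g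
  partitionSum≤-extend {L} {L′} L≤L′ vanish =
    sumBelow-truncate (suc L) (suc L′) (s≤s L≤L′) (λ _ _ → refl) (λ ℓ L<ℓ _ → vanish ℓ L<ℓ)

  partitionSum≤-suc : ∀ L c g → partitionSum≤ (suc L) (suc c) g ≡
    partitionSum≤ (suc L) c g + partitionSum≤ L (tail c) (λ π → g (suc c ∷ π))
  partitionSum≤-suc L c g = begin
    g [] + sumBelow (suc L) (λ ℓ → partitionSum (suc ℓ) (suc c) g)
      ≡⟨ cong (g [] +_) (sumBelow-cong (suc L) (λ ℓ _ → sumBelow-snoc c (first ℓ))) ⟩
    g [] + sumBelow (suc L) (λ ℓ → smaller ℓ + largest ℓ)
      ≡⟨ cong (g [] +_) (sumBelow-+ (suc L) smaller largest) ⟩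
    g [] + (sumBelow (suc L) smaller + sumBelow (suc L) largest)
      ≡⟨ ℤₚ.+-assoc (g []) _ _ ⟨
    partitionSum≤ (suc L) c g + partitionSum≤ L (tail c) (λ π → g (suc c ∷ π))
      ∎
    where
    open ≡-Reasoning
    first : ℕ → ℕ → ℤ
    first ℓ i = partitionSum ℓ (tail i) (λ π → g (suc i ∷ π))
    smaller largest : ℕ → ℤ
    smaller ℓ = partitionSum (suc ℓ) c g
    largest ℓ = partitionSum ℓ (tail c) (λ π → g (suc c ∷ π))

  partitionSum≤-oddWeight-∷ : ∀ L c k n → partitionSum≤ L c (λ π → oddWeight n (k ∷ π)) ≡
                              shift k (λ m → partitionSum≤ L c (evenWeight m)) n
  partitionSum≤-oddWeight-∷ L c zero    n       = refl
  partitionSum≤-oddWeight-∷ L c (suc k) zero    = partitionSum≤-𝟘 L c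
  partitionSum≤-oddWeight-∷ L c (suc k) (suc n) = partitionSum≤-oddWeight-∷ L c k n

  module _ {N : ℕ} (tail≤ : ∀ i → i < N → tail i ≤ N) where

    sumOver-listsOfLength-fits : ∀ ℓ c g → c ≤ N →
      sumOver (listsOfLength N ℓ) (λ xs → if fits c xs then g xs else 0ℤ) ≡ partitionSum ℓ c g
    sumOver-listsOfLength-fits zero    c g c≤N = ℤₚ.+-identityʳ (g [])
    sumOver-listsOfLength-fits (suc ℓ) c g c≤N = begin
      sumOver (listsOfLength N (suc ℓ)) F
        ≡⟨ sumOver-listsOfLength-suc N ℓ F ⟩
      sumOver (listsOfLength N ℓ) (λ xs → F (0 ∷ xs)) + sumBelow N headed
        ≡⟨ cong₂ _+_ (sumOver-zero (listsOfLength N ℓ)) (sumBelow-truncate c N c≤N allowed tooLarge) ⟩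
      0ℤ + partitionSum (suc ℓ) c g
        ≡⟨ ℤₚ.+-identityˡ _ ⟩
      partitionSum (suc ℓ) c g
        ∎
      where
      open ≡-Reasoning
      F : List ℕ → ℤ
      F xs = if fits c xs then g xs else 0ℤ
      headed : ℕ → ℤ
      headed i = sumOver (listsOfLength N ℓ) (λ xs → F (suc i ∷ xs))
      allowed : ∀ i → i < c → headed i ≡ partitionSum ℓ (tail i) (λ π → g (suc i ∷ π))
      allowed i i<c rewrite <ᵇ-true i<c =
        sumOver-listsOfLength-fits ℓ (tail i) (λ π → g (suc i ∷ π)) (tail≤ i (ℕₚ.<-≤-trans i<c c≤N))
      tooLarge : ∀ i → c ≤ i → i < N → headed i ≡ 0ℤ
      tooLarge i c≤i _ rewrite <ᵇ-false c≤i = sumOver-zero (listsOfLength N ℓ)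

    module _ (ordered : List ℕ → Bool) (ordered-[] : ordered [] ≡ true)
             (ordered-[x] : ∀ x → ordered (x ∷ []) ≡ true)
             (ordered-∷ : ∀ y w zs → ordered (suc y ∷ suc w ∷ zs) ≡ (w <ᵇ tail y) ∧ ordered (suc w ∷ zs))
             where

      allIn-ordered-∷≡fits : ∀ y → y < N → ∀ xs → allIn N xs ∧ ordered (suc y ∷ xs) ≡ fits (tail y) xs
      allIn-ordered-∷≡fits y y<N []           = ordered-[x] (suc y)
      allIn-ordered-∷≡fits y y<N (zero ∷ zs)  = refl
      allIn-ordered-∷≡fits y y<N (suc w ∷ zs) rewrite ordered-∷ y w zs
        with w <ᵇ tail y | ℕₚ.<ᵇ⇒< w (tail y)
      ... | true  | w<tail rewrite <ᵇ-true (ℕₚ.<-≤-trans (w<tail _) (tail≤ y y<N)) =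
        allIn-ordered-∷≡fits w (ℕₚ.<-≤-trans (w<tail _) (tail≤ y y<N)) zs
      ... | false | _ = ∧-zeroʳ _

      allIn-ordered≡fits : ∀ π → allIn N π ∧ ordered π ≡ fits N π
      allIn-ordered≡fits []           = ordered-[]
      allIn-ordered≡fits (zero ∷ xs)  = refl
      allIn-ordered≡fits (suc y ∷ xs) with y <ᵇ N | ℕₚ.<ᵇ⇒< y N
      ... | true  | y<N = allIn-ordered-∷≡fits y (y<N _) xs
      ... | false | _   = refl

      sumOver-candidates : ∀ L n →
        sumOver (candidates N L) (λ π → if (allIn N π ∧ ordered π) ∧ (𝒪 π ≡ᵇ n) then sgn (ℰ π) else 0ℤ)
        ≡ partitionSum≤ L N (oddWeight n)
      sumOver-candidates L n = begin
        sumOver (concatMap (listsOfLength N) (upTo (suc L))) F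
          ≡⟨ sumOver-concatMap (listsOfLength N) (upTo (suc L)) F ⟩
        sumOver (upTo (suc L)) (λ ℓ → sumOver (listsOfLength N ℓ) F)
          ≡⟨ sumOver-applyUpTo (suc L) (λ ℓ → ℓ) (λ ℓ → sumOver (listsOfLength N ℓ) F) ⟩
        sumBelow (suc L) (λ ℓ → sumOver (listsOfLength N ℓ) F)
          ≡⟨ sumBelow-cong (suc L) (λ ℓ _ → trans (sumOver-cong (listsOfLength N ℓ) split)
                                                  (sumOver-listsOfLength-fits ℓ N (oddWeight n) ℕₚ.≤-refl)) ⟩
        partitionSum≤ L N (oddWeight n)
          ∎
        where
        open ≡-Reasoning
        F : List ℕ → ℤ
        F π = if (allIn N π ∧ ordered π) ∧ (𝒪 π ≡ᵇ n) then sgn (ℰ π) else 0ℤ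
        split : ∀ π → F π ≡ (if fits N π then oddWeight n π else 0ℤ)
        split π rewrite allIn-ordered≡fits π with fits N π
        ... | true  = refl
        ... | false = refl

genD≡partitionSum≤ : ∀ N n → genD N n ≡ partitionSum≤ (λ i → i) N N (oddWeight n)
genD≡partitionSum≤ N n =
  sumOver-candidates (λ i → i) (λ _ → ℕₚ.<⇒≤) strictlyDecreasing refl (λ _ → refl) (λ _ _ _ → refl) N n

genP≡partitionSum≤ : ∀ N n → genP N n ≡ partitionSum≤ suc (2 ℕ.* n) N (oddWeight n)
genP≡partitionSum≤ N n =
  sumOver-candidates suc (λ _ i<N → i<N) nonIncreasing refl (λ _ → refl) (λ _ _ _ → refl) (2 ℕ.* n) n

distinctPartitionSum-long : ∀ ℓ c g → c < ℓ → partitionSum (λ i → i) ℓ c g ≡ 0ℤ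
distinctPartitionSum-long (suc ℓ) c g (s≤s c≤ℓ) = sumBelow-zero c (λ i i<c →
  distinctPartitionSum-long ℓ i (λ π → g (suc i ∷ π)) (ℕₚ.<-≤-trans i<c c≤ℓ))

distinctPartitionSum≤-suc : ∀ c g → partitionSum≤ (λ i → i) (suc c) (suc c) g ≡
  partitionSum≤ (λ i → i) c c g + partitionSum≤ (λ i → i) c c (λ π → g (suc c ∷ π))
distinctPartitionSum≤-suc c g = trans (partitionSum≤-suc (λ i → i) c c g)
  (cong (_+ partitionSum≤ (λ i → i) c c (λ π → g (suc c ∷ π)))
        (partitionSum≤-extend (λ i → i) (ℕₚ.n≤1+n c) (λ ℓ c<ℓ → distinctPartitionSum-long ℓ c g c<ℓ)))

Gᴰ Hᴰ : ℕ → FPS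
Gᴰ c n = partitionSum≤ (λ i → i) c c (oddWeight n)
Hᴰ c n = partitionSum≤ (λ i → i) c c (evenWeight n)

Gᴰ-suc : ∀ c → Gᴰ (suc c) ≋ Gᴰ c ⊕ shift (suc c) (Hᴰ c)
Gᴰ-suc c n = trans (distinctPartitionSum≤-suc c (oddWeight n))
  (cong (Gᴰ c n +_) (partitionSum≤-oddWeight-∷ (λ i → i) c c (suc c) n))

Hᴰ-suc : ∀ c n → Hᴰ (suc c) n ≡ Hᴰ c n + sgn (suc c) * Gᴰ c n
Hᴰ-suc c n = trans (distinctPartitionSum≤-suc c (evenWeight n)) (cong (Hᴰ c n +_) (trans
  (partitionSum≤-cong (λ i → i) c c (evenWeight-∷ n (suc c)))
  (partitionSum≤-*ˡ (λ i → i) c c (sgn (suc c)) (oddWeight n))))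

mutual
  length≤2𝒪 : ∀ {π} → All (1 ≤_) π → length π ≤ 2 ℕ.* 𝒪 π
  length≤2𝒪 []                     = z≤n
  length≤2𝒪 {suc x ∷ xs} (_ ∷ pos) = begin
    suc (length xs)           ≤⟨ s≤s (length≤1+2ℰ pos) ⟩
    2 ℕ.+ 2 ℕ.* ℰ xs          ≡⟨ ℕₚ.*-suc 2 (ℰ xs) ⟨
    2 ℕ.* suc (ℰ xs)          ≤⟨ ℕₚ.*-monoʳ-≤ 2 (s≤s (ℕₚ.m≤n+m (ℰ xs) x)) ⟩
    2 ℕ.* (suc x ℕ.+ ℰ xs)    ∎
    where open ℕₚ.≤-Reasoning

  length≤1+2ℰ : ∀ {π} → All (1 ≤_) π → length π ≤ suc (2 ℕ.* ℰ π)
  length≤1+2ℰ []        = z≤n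
  length≤1+2ℰ (_ ∷ pos) = s≤s (length≤2𝒪 pos)

oddWeight-long : ∀ n π → All (1 ≤_) π → 2 ℕ.* n < length π → oddWeight n π ≡ 0ℤ
oddWeight-long n π pos long with 𝒪 π ≡ᵇ n | ℕₚ.≡ᵇ⇒≡ (𝒪 π) n
... | true  | 𝒪≡n =
  ⊥-elim (ℕₚ.<⇒≱ long (subst (λ o → length π ≤ 2 ℕ.* o) (𝒪≡n _) (length≤2𝒪 pos)))
... | false | _   = refl

evenWeight-long : ∀ n π → All (1 ≤_) π → suc (2 ℕ.* n) < length π → evenWeight n π ≡ 0ℤ
evenWeight-long n π pos long with ℰ π ≡ᵇ n | ℕₚ.≡ᵇ⇒≡ (ℰ π) n
... | true  | ℰ≡n =
  ⊥-elim (ℕₚ.<⇒≱ long (subst (λ e → length π ≤ suc (2 ℕ.* e)) (ℰ≡n _) (length≤1+2ℰ pos)))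
... | false | _   = refl

-- The length bounds lose nothing: longer partitions contribute 0 (oddWeight-long, evenWeight-long).
Gᴾ Hᴾ : ℕ → FPS
Gᴾ c n = partitionSum≤ suc (2 ℕ.* n) c (oddWeight n)
Hᴾ c n = partitionSum≤ suc (suc (2 ℕ.* n)) c (evenWeight n)

Gᴾ-stable : ∀ {L} c n → 2 ℕ.* n ≤ L → partitionSum≤ suc L c (oddWeight n) ≡ Gᴾ c n
Gᴾ-stable c n 2n≤L = partitionSum≤-extend suc 2n≤L (λ ℓ long → partitionSum-vanishes suc ℓ c
  (λ π pos len → oddWeight-long n π pos (subst (2 ℕ.* n <_) (sym len) long)))

Hᴾ-stable : ∀ {L} c n → suc (2 ℕ.* n) ≤ L → partitionSum≤ suc L c (evenWeight n) ≡ Hᴾ c n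
Hᴾ-stable c n 2n+1≤L = partitionSum≤-extend suc 2n+1≤L (λ ℓ long → partitionSum-vanishes suc ℓ c
  (λ π pos len → evenWeight-long n π pos (subst (suc (2 ℕ.* n) <_) (sym len) long)))

Gᴾ-suc : ∀ c n → Gᴾ (suc c) n ≡ Gᴾ c n + shift (suc c) (Hᴾ (suc c)) n
Gᴾ-suc c n = begin
  Gᴾ (suc c) n
    ≡⟨ Gᴾ-stable (suc c) n (ℕₚ.n≤1+n _) ⟨
  partitionSum≤ suc (suc (2 ℕ.* n)) (suc c) (oddWeight n)
    ≡⟨ partitionSum≤-suc suc (2 ℕ.* n) c (oddWeight n) ⟩
  partitionSum≤ suc (suc (2 ℕ.* n)) c (oddWeight n) +
  partitionSum≤ suc (2 ℕ.* n) (suc c) (λ π → oddWeight n (suc c ∷ π))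
    ≡⟨ cong₂ _+_ (Gᴾ-stable c n (ℕₚ.n≤1+n _))
                 (partitionSum≤-oddWeight-∷ suc (2 ℕ.* n) (suc c) (suc c) n) ⟩
  Gᴾ c n + shift (suc c) (λ m → partitionSum≤ suc (2 ℕ.* n) (suc c) (evenWeight m)) n
    ≡⟨ cong (Gᴾ c n +_) (shift-congᵗ (suc c) n (λ m e → Hᴾ-stable (suc c) m (bound m e))) ⟩
  Gᴾ c n + shift (suc c) (Hᴾ (suc c)) n
    ∎
  where
  open ≡-Reasoning
  bound : ∀ m → m ℕ.+ suc c ≡ n → suc (2 ℕ.* m) ≤ 2 ℕ.* n
  bound m refl = ℕₚ.≤-trans (ℕₚ.n≤1+n _)
    (subst (_≤ 2 ℕ.* (m ℕ.+ suc c)) (ℕₚ.*-suc 2 m) (ℕₚ.*-monoʳ-≤ 2 (ℕₚ.m<m+n m (s≤s z≤n))))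

Hᴾ-suc : ∀ c n → Hᴾ (suc c) n ≡ Hᴾ c n + sgn (suc c) * Gᴾ (suc c) n
Hᴾ-suc c n = trans (partitionSum≤-suc suc (2 ℕ.* n) c (evenWeight n)) (cong (Hᴾ c n +_) (trans
  (partitionSum≤-cong suc (2 ℕ.* n) (suc c) (evenWeight-∷ n (suc c)))
  (partitionSum≤-*ˡ suc (2 ℕ.* n) (suc c) (sgn (suc c)) (oddWeight n))))

sgn-even : ∀ m → sgn (m ℕ.+ m) ≡ 1ℤ
sgn-even zero    = refl
sgn-even (suc m) rewrite ℕₚ.+-suc m m | sgn-even m = refl

sgn-odd : ∀ m → sgn (suc (m ℕ.+ m)) ≡ -1ℤ
sgn-odd m rewrite sgn-even m = refl

mutual
  Gᴰ-Hᴰ-even : ∀ m → Gᴰ (m ℕ.+ m) ≋ Pᴰ m × Hᴰ (m ℕ.+ m) ≋ Pᴰ m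
  Gᴰ-Hᴰ-even zero    = (λ n → trans (partitionSum≤-0 (λ i → i) 0 (oddWeight n)) (weight-[] n))
                     , (λ n → trans (partitionSum≤-0 (λ i → i) 0 (evenWeight n)) (weight-[] n))
  Gᴰ-Hᴰ-even (suc m) rewrite ℕₚ.+-suc m m = G , H
    where
    c = suc (m ℕ.+ m)
    odd = Gᴰ-Hᴰ-odd m
    G : Gᴰ (suc c) ≋ Pᴰ (suc m)
    G n = begin
      Gᴰ (suc c) n
        ≡⟨ Gᴰ-suc c n ⟩
      Gᴰ c n + shift (suc c) (Hᴰ c) n
        ≡⟨ cong₂ _+_ (proj₁ odd n) (trans (shift-cong (suc c) (proj₂ odd) n) (shift-𝟘 (suc c) n)) ⟩
      Pᴰ (suc m) n + 0ℤ
        ≡⟨ ℤₚ.+-identityʳ _ ⟩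
      Pᴰ (suc m) n
        ∎
      where open ≡-Reasoning
    H : Hᴰ (suc c) ≋ Pᴰ (suc m)
    H n = begin
      Hᴰ (suc c) n
        ≡⟨ Hᴰ-suc c n ⟩
      Hᴰ c n + sgn (suc c) * Gᴰ c n
        ≡⟨ cong₂ _+_ (proj₂ odd n) (cong₂ _*_ (cong (-1ℤ *_) (sgn-odd m)) (proj₁ odd n)) ⟩
      0ℤ + 1ℤ * Pᴰ (suc m) n
        ≡⟨ trans (ℤₚ.+-identityˡ _) (ℤₚ.*-identityˡ _) ⟩
      Pᴰ (suc m) n
        ∎
      where open ≡-Reasoning

  Gᴰ-Hᴰ-odd : ∀ m → Gᴰ (suc (m ℕ.+ m)) ≋ Pᴰ (suc m) × Hᴰ (suc (m ℕ.+ m)) ≋ 𝟘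
  Gᴰ-Hᴰ-odd m = G , H
    where
    c = m ℕ.+ m
    even = Gᴰ-Hᴰ-even m
    G : Gᴰ (suc c) ≋ Pᴰ (suc m)
    G = begin
      Gᴰ (suc c)                      ≈⟨ Gᴰ-suc c ⟩
      Gᴰ c ⊕ shift (suc c) (Hᴰ c)     ≈⟨ ⊕-cong (proj₁ even) (shift-cong (suc c) (proj₂ even)) ⟩
      Pᴰ m ⊕ shift (suc c) (Pᴰ m)     ≈⟨ Pᴰ-suc m ⟨
      Pᴰ (suc m)                      ∎
      where open ≋-Reasoning
    H : Hᴰ (suc c) ≋ 𝟘
    H n = begin
      Hᴰ (suc c) n                    ≡⟨ Hᴰ-suc c n ⟩
      Hᴰ c n + sgn (suc c) * Gᴰ c n   ≡⟨ cong₂ _+_ (proj₂ even n) (cong₂ _*_ (sgn-odd m) (proj₁ even n)) ⟩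
      Pᴰ m n + -1ℤ * Pᴰ m n           ≡⟨ cancel (Pᴰ m n) ⟩
      0ℤ                              ∎
      where
      open ≡-Reasoning
      cancel : ∀ a → a + -1ℤ * a ≡ 0ℤ
      cancel = solve-∀

mutual
  Gᴾ-Hᴾ-even : ∀ m → Gᴾ (m ℕ.+ m) ⊛ Pᴾ m ≋ 𝟙 × Hᴾ (m ℕ.+ m) ≋ Gᴾ (m ℕ.+ m)
  Gᴾ-Hᴾ-even zero = (λ n → trans (⊛-identityʳ (Gᴾ 0) n) (G₀≋𝟙 n))
                  , (λ n → trans (H₀≋𝟙 n) (sym (G₀≋𝟙 n)))
    where
    G₀≋𝟙 : Gᴾ 0 ≋ 𝟙
    G₀≋𝟙 n = trans (partitionSum≤-0 suc (2 ℕ.* n) (oddWeight n)) (weight-[] n)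
    H₀≋𝟙 : Hᴾ 0 ≋ 𝟙
    H₀≋𝟙 n = trans (partitionSum≤-0 suc (suc (2 ℕ.* n)) (evenWeight n)) (weight-[] n)
  Gᴾ-Hᴾ-even (suc m) rewrite ℕₚ.+-suc m m = G , H
    where
    c = suc (m ℕ.+ m)
    odd = Gᴾ-Hᴾ-odd m
    G′ = Gᴾ (suc c)
    H : Hᴾ (suc c) ≋ G′
    H n = begin
      Hᴾ (suc c) n
        ≡⟨ Hᴾ-suc c n ⟩
      Hᴾ c n + sgn (suc c) * G′ n
        ≡⟨ cong₂ _+_ (proj₂ odd n) (cong (_* G′ n) (cong (-1ℤ *_) (sgn-odd m))) ⟩
      0ℤ + 1ℤ * G′ n
        ≡⟨ trans (ℤₚ.+-identityˡ _) (ℤₚ.*-identityˡ _) ⟩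
      G′ n
        ∎
      where open ≡-Reasoning
    telescope : G′ ⊖ shift (suc c) G′ ≋ Gᴾ (m ℕ.+ m)
    telescope n = begin
      G′ n + - shift (suc c) G′ n
        ≡⟨ cong (_+ - shift (suc c) G′ n) (Gᴾ-suc c n) ⟩
      (Gᴾ c n + shift (suc c) (Hᴾ (suc c)) n) + - shift (suc c) G′ n
        ≡⟨ cong (λ x → (Gᴾ c n + x) + - shift (suc c) G′ n) (shift-cong (suc c) H n) ⟩
      (Gᴾ c n + shift (suc c) G′ n) + - shift (suc c) G′ n
        ≡⟨ cancel (Gᴾ c n) (shift (suc c) G′ n) ⟩
      Gᴾ c n
        ≡⟨ proj₁ odd n ⟩
      Gᴾ (m ℕ.+ m) n
        ∎
      where
      open ≡-Reasoning
      cancel : ∀ a b → (a + b) + - b ≡ a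
      cancel = solve-∀
    G : G′ ⊛ Pᴾ (suc m) ≋ 𝟙
    G = begin
      G′ ⊛ Pᴾ (suc m)                      ≈⟨ ⊛-congʳ G′ (Pᴾ-suc m) ⟩
      G′ ⊛ (Pᴾ m ⊖ shift (suc c) (Pᴾ m))   ≈⟨ ⊛-⊖-shift-swap (suc c) G′ (Pᴾ m) ⟩
      (G′ ⊖ shift (suc c) G′) ⊛ Pᴾ m       ≈⟨ ⊛-congˡ (Pᴾ m) telescope ⟩
      Gᴾ (m ℕ.+ m) ⊛ Pᴾ m                  ≈⟨ proj₁ (Gᴾ-Hᴾ-even m) ⟩
      𝟙                                    ∎
      where open ≋-Reasoning

  Gᴾ-Hᴾ-odd : ∀ m → Gᴾ (suc (m ℕ.+ m)) ≋ Gᴾ (m ℕ.+ m) × Hᴾ (suc (m ℕ.+ m)) ≋ 𝟘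
  Gᴾ-Hᴾ-odd m = G , H
    where
    c = m ℕ.+ m
    even = Gᴾ-Hᴾ-even m
    H′ = Hᴾ (suc c)
    H : H′ ≋ 𝟘
    H = ⊕-shift≋𝟘⇒≋𝟘 c H′ λ n → let s = shift (suc c) H′ n in begin
      H′ n + s
        ≡⟨ cong (_+ s) (Hᴾ-suc c n) ⟩
      (Hᴾ c n + sgn (suc c) * Gᴾ (suc c) n) + s
        ≡⟨ cong (_+ s) (cong₂ _+_ (proj₂ even n) (cong₂ _*_ (sgn-odd m) (Gᴾ-suc c n))) ⟩
      (Gᴾ c n + -1ℤ * (Gᴾ c n + s)) + s
        ≡⟨ cancel (Gᴾ c n) s ⟩
      0ℤ
        ∎
      where
      open ≡-Reasoning
      cancel : ∀ a b → (a + -1ℤ * (a + b)) + b ≡ 0ℤ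
      cancel = solve-∀
    G : Gᴾ (suc c) ≋ Gᴾ c
    G n = begin
      Gᴾ (suc c) n                 ≡⟨ Gᴾ-suc c n ⟩
      Gᴾ c n + shift (suc c) H′ n  ≡⟨ cong (Gᴾ c n +_) (trans (shift-cong (suc c) H n) (shift-𝟘 (suc c) n)) ⟩
      Gᴾ c n + 0ℤ                  ≡⟨ ℤₚ.+-identityʳ _ ⟩
      Gᴾ c n                       ∎
      where open ≡-Reasoning

parity : ∀ N → ∃ λ m → N ≡ m ℕ.+ m ⊎ N ≡ suc (m ℕ.+ m)
parity zero = 0 , inj₁ refl
parity (suc N) with parity N
... | m , inj₁ N≡2m   = m , inj₂ (cong suc N≡2m)
... | m , inj₂ N≡2m+1 = suc m , inj₁ (trans (cong suc N≡2m+1) (sym (ℕₚ.+-suc (suc m) m)))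

genD≋Pᴰ : ∀ N → genD N ≋ Pᴰ ⌈ N /2⌉
genD≋Pᴰ N with parity N
... | m , inj₁ refl = subst (λ k → genD (m ℕ.+ m) ≋ Pᴰ k) (ℕₚ.n≡⌈n+n/2⌉ m)
  (λ n → trans (genD≡partitionSum≤ (m ℕ.+ m) n) (proj₁ (Gᴰ-Hᴰ-even m) n))
... | m , inj₂ refl = subst (λ k → genD (suc (m ℕ.+ m)) ≋ Pᴰ (suc k)) (ℕₚ.n≡⌊n+n/2⌋ m)
  (λ n → trans (genD≡partitionSum≤ (suc (m ℕ.+ m)) n) (proj₁ (Gᴰ-Hᴰ-odd m) n))

genP⊛Pᴾ≋𝟙 : ∀ N → genP N ⊛ Pᴾ ⌊ N /2⌋ ≋ 𝟙
genP⊛Pᴾ≋𝟙 N with parity N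
... | m , inj₁ refl = subst (λ k → genP (m ℕ.+ m) ⊛ Pᴾ k ≋ 𝟙) (ℕₚ.n≡⌊n+n/2⌋ m)
  (λ n → trans (⊛-congˡ (Pᴾ m) (genP≡partitionSum≤ (m ℕ.+ m)) n) (proj₁ (Gᴾ-Hᴾ-even m) n))
... | m , inj₂ refl = subst (λ k → genP (suc (m ℕ.+ m)) ⊛ Pᴾ k ≋ 𝟙) (ℕₚ.n≡⌈n+n/2⌉ m)
  (λ n → trans (⊛-congˡ (Pᴾ m) genP≋Gᴾ n) (proj₁ (Gᴾ-Hᴾ-even m) n))
  where
  genP≋Gᴾ : genP (suc (m ℕ.+ m)) ≋ Gᴾ (m ℕ.+ m)
  genP≋Gᴾ i = trans (genP≡partitionSum≤ (suc (m ℕ.+ m)) i) (proj₁ (Gᴾ-Hᴾ-odd m) i)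

theorem4p4 : (N : ℕ) →
    (genD N ≋ poch (⊝ 𝕢) (𝕢 ^^ 2) ⌈ N /2⌉)
    × (genP N ⊛ poch (𝕢 ^^ 2) (𝕢 ^^ 2) ⌊ N /2⌋ ≋ 𝟙)
theorem4p4 N = genD≋Pᴰ N , genP⊛Pᴾ≋𝟙 N
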